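{- Let $n,j,z\in\mathbb{N}$. Then the Jacobi-Stirling number of the second kind $JS_n^{(j)}(z)$ equals the number of pairs $(s_1,s_2)\in\overline S^j_{j}\times\overline S^j_{j+z}$ such that $s_1$ and $s_2$ have the same ordered structure and dimension $n-j$.
   Context: $JS_n^{(j)}(z)=h_{n-j}\big(1(1+z),2(2+z),\dots,j(j+z)\big)$, where $h_m$ is the complete homogeneous symmetric polynomial of degree $m$ ($h_0=1$, $h_m=0$ for $m<0$, $h_m()=0$ for $m\ge1$). For $m,h\in\mathbb{N}$, $\overline S_m^h$ is the set of ordered lists of $h$ finite sequences $(u^{(1)},\dots,u^{(h)})$, where $u^{(i)}$ is a (possibly empty) finite sequence of integers from $\{i,\dots,m\}$; its dimension is the sum of the lengths of the $u^{(i)}$. Two such elements have the same ordered structure if for every $i$ their $i$-th sequences have the same length. -}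

module Defs where

open import Data.Nat using (ℕ; zero; suc; _+_; _*_; _∸_; _≤_; _≤?_)
open import Data.List using (List; []; _∷_; length; map)
open import Data.Product using (Σ; _×_; _,_; proj₁)
open import Data.Unit using (⊤; tt)
open import Relation.Binary.PropositionalEquality using (_≡_)
open import Relation.Nullary using (yes; no)

-- complete homogeneous symmetric polynomial h_m evaluated at a list of naturals:
-- h_0 = 1, h_m() = 0 for m ≥ 1, and
-- h_m(x, xs) = x * h_{m-1}(x, xs) + h_m(xs)   (monomials using x at least once, or not at all)
hpoly : ℕ → List ℕ → ℕ
hpoly zero      _        = 1
hpoly (suc m)   []       = 0
hpoly (suc m)   (x ∷ xs) = x * hpoly m (x ∷ xs) + hpoly (suc m) xs

jsArgs : ℕ → ℕ → List ℕ
jsArgs zero    z = []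
jsArgs (suc j) z = jsArgs j z Data.List.++ (suc j * (suc j + z) ∷ [])

JS : ℕ → ℕ → ℕ → ℕ
JS n j z with j ≤? n
... | yes _ = hpoly (n ∸ j) (jsArgs j z)
... | no  _ = 0

Bounded : ℕ → ℕ → Set
Bounded i m = Σ ℕ (λ x → i ≤ x × x ≤ m)

SBar' : ℕ → ℕ → ℕ → Set
SBar' i m zero    = ⊤
SBar' i m (suc h) = List (Bounded i m) × SBar' (suc i) m h

-- \overline S_m^h : ordered lists of h sequences, the i-th (1-based) taking values in {i,...,m}
SBar : ℕ → ℕ → Set
SBar m h = SBar' 1 m h

dim' : ∀ {i m} h → SBar' i m h → ℕ
dim' zero    _        = 0
dim' (suc h) (u , us) = length u + dim' h us

dim : ∀ {m} h → SBar m h → ℕ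
dim h s = dim' h s

structure' : ∀ {i m} h → SBar' i m h → List ℕ
structure' zero    _        = []
structure' (suc h) (u , us) = length u ∷ structure' h us

structure : ∀ {m} h → SBar m h → List ℕ
structure h s = structure' h s

SameStructure : ∀ {m m'} h → SBar m h → SBar m' h → Set
SameStructure h s₁ s₂ = structure h s₁ ≡ structure h s₂

module Submission where

-- A pair (s₁, s₂) with the same ordered structure is the same thing as a list of h
-- sequences of pairs, the i-th drawn from {i,…,m₁} × {i,…,m₂}, a set with
-- (m₁+1-i)(m₂+1-i) elements.  Counting such lists of total length d by whether the
-- first sequence is empty gives exactly the defining recursion of h_d evaluated at
-- these box sizes.  For m₁ = j and m₂ = j + z the box sizes are j(j+z), …, 1(1+z):
-- the arguments of JS_n^{(j)}(z) in reverse order, and h_d is symmetric.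

open import Defs
open import Data.Nat using (ℕ; zero; suc; _+_; _*_; _∸_; _≤_; _<_; _≤?_; s≤s; s≤s⁻¹)
open import Data.Nat.Properties
open import Data.Nat.Solver using (module +-*-Solver)
open +-*-Solver using (solve; _:+_; _:*_; _:=_)
open import Algebra.Properties.CommutativeSemigroup +-commutativeSemigroup using (x∙yz≈y∙xz)
open import Data.Fin using (Fin; toℕ; fromℕ<)
open import Data.Fin.Properties using (toℕ-fromℕ<; toℕ<n; toℕ-injective; +↔⊎; *↔×; 1↔⊤; 0↔⊥)
open import Data.List using (List; []; _∷_)
open import Data.List.Properties using (∷-injectiveˡ; ∷-injectiveʳ; ≡-dec)
open import Data.List.Relation.Binary.Permutation.Propositional
  using (_↭_; refl; prep; swap; trans; ↭-sym; module PermutationReasoning)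
open import Data.List.Relation.Binary.Permutation.Propositional.Properties using (∷↭∷ʳ)
open import Data.Product using (Σ; _×_; _,_; proj₁; proj₂)
open import Data.Product.Function.NonDependent.Propositional using (_×-↔_)
open import Data.Sum using (_⊎_; inj₁; inj₂)
open import Data.Sum.Function.Propositional using (_⊎-↔_)
open import Data.Unit using (⊤; tt)
open import Data.Empty using (⊥; ⊥-elim)
open import Relation.Binary.PropositionalEquality
  using (_≡_; refl; sym; cong; cong₂; subst; module ≡-Reasoning)
  renaming (trans to ≡-trans)
open import Relation.Nullary using (yes; no; ¬_)
open import Axiom.UniquenessOfIdentityProofs using (module Decidable⇒UIP)
open import Function.Bundles using (_↔_; mk↔ₛ′)
open import Function.Properties.Inverse using (↔-trans; ↔-sym; ↔-refl)

-- The right-hand side is symmetric in x and y as soon as h_{d+1}(x,y,R) is; the term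
-- x y h_d is moved to the left so that no subtraction occurs.
hpoly-two-step : ∀ x y xs d →
  hpoly (suc (suc d)) (x ∷ y ∷ xs) + x * y * hpoly d (x ∷ y ∷ xs)
  ≡ x * hpoly (suc d) (x ∷ y ∷ xs) + y * hpoly (suc d) (x ∷ y ∷ xs) + hpoly (suc (suc d)) xs
hpoly-two-step x y xs d =
  solve 5 (λ x y a b c →
    x :* (x :* a :+ b) :+ (y :* b :+ c) :+ x :* y :* a
    := x :* (x :* a :+ b) :+ y :* (x :* a :+ b) :+ c)
    refl x y (hpoly d (x ∷ y ∷ xs)) (hpoly (suc d) (y ∷ xs)) (hpoly (suc (suc d)) xs)

hpoly-swap : ∀ x y xs d → hpoly d (x ∷ y ∷ xs) ≡ hpoly d (y ∷ x ∷ xs)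
hpoly-swap x y xs zero          = refl
hpoly-swap x y xs (suc zero)    = x∙yz≈y∙xz (x * 1) (y * 1) (hpoly 1 xs)
hpoly-swap x y xs (suc (suc d)) =
  +-cancelʳ-≡ (x * y * hpoly d (x ∷ y ∷ xs)) _ _ (begin
    hpoly (2 + d) (x ∷ y ∷ xs) + x * y * hpoly d (x ∷ y ∷ xs)
      ≡⟨ hpoly-two-step x y xs d ⟩
    x * hpoly (suc d) (x ∷ y ∷ xs) + y * hpoly (suc d) (x ∷ y ∷ xs) + hpoly (2 + d) xs
      ≡⟨ cong (λ t → x * t + y * t + hpoly (2 + d) xs) (hpoly-swap x y xs (suc d)) ⟩
    x * hpoly (suc d) (y ∷ x ∷ xs) + y * hpoly (suc d) (y ∷ x ∷ xs) + hpoly (2 + d) xs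
      ≡⟨ cong (_+ hpoly (2 + d) xs) (+-comm (x * _) (y * _)) ⟩
    y * hpoly (suc d) (y ∷ x ∷ xs) + x * hpoly (suc d) (y ∷ x ∷ xs) + hpoly (2 + d) xs
      ≡⟨ hpoly-two-step y x xs d ⟨
    hpoly (2 + d) (y ∷ x ∷ xs) + y * x * hpoly d (y ∷ x ∷ xs)
      ≡⟨ cong₂ (λ a b → hpoly (2 + d) (y ∷ x ∷ xs) + a * b) (*-comm y x) (hpoly-swap y x xs d) ⟩
    hpoly (2 + d) (y ∷ x ∷ xs) + x * y * hpoly d (x ∷ y ∷ xs) ∎)
  where open ≡-Reasoning

hpoly-prep : ∀ x {xs ys} → (∀ d → hpoly d xs ≡ hpoly d ys) → ∀ d → hpoly d (x ∷ xs) ≡ hpoly d (x ∷ ys)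
hpoly-prep x eq zero    = refl
hpoly-prep x eq (suc d) = cong₂ (λ a b → x * a + b) (hpoly-prep x eq d) (eq (suc d))

hpoly-↭ : ∀ {xs ys} → xs ↭ ys → ∀ d → hpoly d xs ≡ hpoly d ys
hpoly-↭ refl           d = refl
hpoly-↭ (prep x p)     d = hpoly-prep x (hpoly-↭ p) d
hpoly-↭ (swap x y p)   d =
  ≡-trans (hpoly-swap x y _ d) (hpoly-prep y (hpoly-prep x (hpoly-↭ p)) d)
hpoly-↭ (trans p q)    d = ≡-trans (hpoly-↭ p d) (hpoly-↭ q d)

boxSizes : ℕ → ℕ → ℕ → ℕ → List ℕ
boxSizes m₁ m₂ i zero    = []
boxSizes m₁ m₂ i (suc h) = (suc m₁ ∸ i) * (suc m₂ ∸ i) ∷ boxSizes m₁ m₂ (suc i) h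

boxSizes↭jsArgs : ∀ z k h → boxSizes (k + h) (k + h + z) (suc k) h ↭ jsArgs h z
boxSizes↭jsArgs z k zero    = refl
boxSizes↭jsArgs z k (suc h) = begin
  boxSizes (k + suc h) (k + suc h + z) (suc k) (suc h)
    ≡⟨ cong₂ _∷_ headSize (cong (λ t → boxSizes t (t + z) (2 + k) h) (+-suc k h)) ⟩
  suc h * (suc h + z) ∷ boxSizes (suc k + h) (suc k + h + z) (2 + k) h
    ↭⟨ prep _ (boxSizes↭jsArgs z (suc k) h) ⟩
  suc h * (suc h + z) ∷ jsArgs h z
    ↭⟨ ∷↭∷ʳ _ _ ⟩
  jsArgs (suc h) z ∎
  where
  open PermutationReasoning
  headSize : (suc (k + suc h) ∸ suc k) * (suc (k + suc h + z) ∸ suc k) ≡ suc h * (suc h + z)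
  headSize = cong₂ _*_ (m+n∸m≡n k (suc h))
                       (≡-trans (cong (_∸ k) (+-assoc k (suc h) z)) (m+n∸m≡n k (suc h + z)))

m<n∸o⇒m+o<n : ∀ m n o → m < n ∸ o → m + o < n
m<n∸o⇒m+o<n m n       zero    m<n = subst (_< n) (sym (+-identityʳ m)) m<n
m<n∸o⇒m+o<n m zero    (suc o) ()
m<n∸o⇒m+o<n m (suc n) (suc o) lt  = subst (_< suc n) (sym (+-suc m o)) (s≤s (m<n∸o⇒m+o<n m n o lt))

Bounded-≡ : ∀ {i m} {a b : Bounded i m} → proj₁ a ≡ proj₁ b → a ≡ b
Bounded-≡ {a = x , p , q} {b = .x , p′ , q′} refl =
  cong₂ (λ u v → x , u , v) (≤-irrelevant p p′) (≤-irrelevant q q′)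

Bounded↔Fin : ∀ i m → Bounded i m ↔ Fin (suc m ∸ i)
Bounded↔Fin i m = mk↔ₛ′ to from to∘from from∘to
  where
  to : Bounded i m → Fin (suc m ∸ i)
  to (x , i≤x , x≤m) = fromℕ< (∸-monoˡ-< (s≤s x≤m) i≤x)
  from : Fin (suc m ∸ i) → Bounded i m
  from k = toℕ k + i , m≤n+m i (toℕ k) , s≤s⁻¹ (m<n∸o⇒m+o<n (toℕ k) (suc m) i (toℕ<n k))
  to∘from : ∀ k → to (from k) ≡ k
  to∘from k = toℕ-injective (≡-trans (toℕ-fromℕ< _) (m+n∸n≡m (toℕ k) i))
  from∘to : ∀ b → from (to b) ≡ b
  from∘to (x , i≤x , x≤m) = Bounded-≡ (≡-trans (cong (_+ i) (toℕ-fromℕ< _)) (m∸n+n≡m i≤x))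

List-≡-irrelevant : ∀ {a b : List ℕ} (p q : a ≡ b) → p ≡ q
List-≡-irrelevant = Decidable⇒UIP.≡-irrelevant (≡-dec _≟_)

module _ (m₁ m₂ : ℕ) where

  SamePairs : ℕ → ℕ → ℕ → Set
  SamePairs i h d = Σ (SBar' i m₁ h × SBar' i m₂ h)
    (λ p → structure' h (proj₁ p) ≡ structure' h (proj₂ p) × dim' h (proj₁ p) ≡ d)

  SamePairs-≡ : ∀ {i h d} {p q : SamePairs i h d} → proj₁ p ≡ proj₁ q → p ≡ q
  SamePairs-≡ {p = s , st , dm} {q = .s , st′ , dm′} refl =
    cong₂ (λ u v → s , u , v) (List-≡-irrelevant st st′) (≡-irrelevant dm dm′)

  allEmpty : ∀ i h → SamePairs i h 0
  allEmpty i zero    = (tt , tt) , refl , refl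
  allEmpty i (suc h) with (us , vs) , st , dm ← allEmpty (suc i) h =
    (([] , us) , ([] , vs)) , cong (0 ∷_) st , dm

  allEmpty-unique : ∀ i h (p : SamePairs i h 0) → allEmpty i h ≡ p
  allEmpty-unique i zero    _ = SamePairs-≡ {i} {zero} refl
  allEmpty-unique i (suc h) (((_ ∷ _ , _) , _) , _ , ())
  allEmpty-unique i (suc h) ((([] , us) , (_ ∷ _ , vs)) , st , _) with () ← ∷-injectiveˡ st
  allEmpty-unique i (suc h) ((([] , us) , ([] , vs)) , st , dm) =
    SamePairs-≡ (cong (λ p → ([] , proj₁ (proj₁ p)) , ([] , proj₂ (proj₁ p)))
                      (allEmpty-unique (suc i) h ((us , vs) , ∷-injectiveʳ st , dm)))

  SamePairs-empty↔⊤ : ∀ i h → SamePairs i h 0 ↔ ⊤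
  SamePairs-empty↔⊤ i h = mk↔ₛ′ _ (λ _ → allEmpty i h) (λ _ → refl) (allEmpty-unique i h)

  SamePairs-noSequence↔⊥ : ∀ i d → SamePairs i 0 (suc d) ↔ ⊥
  SamePairs-noSequence↔⊥ i d = mk↔ₛ′ (λ { (_ , _ , ()) }) (λ ()) (λ ()) (λ { (_ , _ , ()) })

  SamePairs-split : ∀ i h d → SamePairs i (suc h) (suc d) ↔
    (((Bounded i m₁ × Bounded i m₂) × SamePairs i (suc h) d) ⊎ SamePairs (suc i) h (suc d))
  SamePairs-split i h d = mk↔ₛ′ to from to∘from from∘to
    where
    to : SamePairs i (suc h) (suc d) →
         ((Bounded i m₁ × Bounded i m₂) × SamePairs i (suc h) d) ⊎ SamePairs (suc i) h (suc d)
    to ((([] , us) , ([] , vs)) , st , dm) = inj₂ ((us , vs) , ∷-injectiveʳ st , dm)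
    to ((([] , us) , (b ∷ v , vs)) , st , dm) with () ← ∷-injectiveˡ st
    to (((a ∷ u , us) , ([] , vs)) , st , dm) with () ← ∷-injectiveˡ st
    to (((a ∷ u , us) , (b ∷ v , vs)) , st , dm) =
      inj₁ ((a , b) , ((u , us) , (v , vs)) ,
            cong₂ _∷_ (suc-injective (∷-injectiveˡ st)) (∷-injectiveʳ st) , suc-injective dm)
    from : ((Bounded i m₁ × Bounded i m₂) × SamePairs i (suc h) d) ⊎ SamePairs (suc i) h (suc d) →
           SamePairs i (suc h) (suc d)
    from (inj₂ ((us , vs) , st , dm)) = (([] , us) , ([] , vs)) , cong (0 ∷_) st , dm
    from (inj₁ ((a , b) , ((u , us) , (v , vs)) , st , dm)) =
      ((a ∷ u , us) , (b ∷ v , vs)) ,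
      cong₂ _∷_ (cong suc (∷-injectiveˡ st)) (∷-injectiveʳ st) , cong suc dm
    to∘from : ∀ y → to (from y) ≡ y
    to∘from (inj₂ _)       = cong inj₂ (SamePairs-≡ refl)
    to∘from (inj₁ (ab , _)) = cong (λ q → inj₁ (ab , q)) (SamePairs-≡ refl)
    from∘to : ∀ x → from (to x) ≡ x
    from∘to ((([] , us) , ([] , vs)) , st , dm) = SamePairs-≡ refl
    from∘to ((([] , us) , (b ∷ v , vs)) , st , dm) with () ← ∷-injectiveˡ st
    from∘to (((a ∷ u , us) , ([] , vs)) , st , dm) with () ← ∷-injectiveˡ st
    from∘to (((a ∷ u , us) , (b ∷ v , vs)) , st , dm) = SamePairs-≡ refl

  Fin-hpoly↔SamePairs : ∀ i h d → Fin (hpoly d (boxSizes m₁ m₂ i h)) ↔ SamePairs i h d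
  Fin-hpoly↔SamePairs i h       zero    = ↔-trans 1↔⊤ (↔-sym (SamePairs-empty↔⊤ i h))
  Fin-hpoly↔SamePairs i zero    (suc d) = ↔-trans 0↔⊥ (↔-sym (SamePairs-noSequence↔⊥ i d))
  Fin-hpoly↔SamePairs i (suc h) (suc d) =
    ↔-trans +↔⊎ (↔-trans (firstNonempty ⊎-↔ Fin-hpoly↔SamePairs (suc i) h (suc d))
                         (↔-sym (SamePairs-split i h d)))
    where
    box : Fin ((suc m₁ ∸ i) * (suc m₂ ∸ i)) ↔ (Bounded i m₁ × Bounded i m₂)
    box = ↔-trans *↔× (↔-sym (Bounded↔Fin i m₁) ×-↔ ↔-sym (Bounded↔Fin i m₂))
    firstNonempty : Fin ((suc m₁ ∸ i) * (suc m₂ ∸ i) * hpoly d (boxSizes m₁ m₂ i (suc h))) ↔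
                    ((Bounded i m₁ × Bounded i m₂) × SamePairs i (suc h) d)
    firstNonempty = ↔-trans *↔× (box ×-↔ Fin-hpoly↔SamePairs i (suc h) d)

≡⇒Fin↔ : ∀ {a b} → a ≡ b → Fin a ↔ Fin b
≡⇒Fin↔ refl = ↔-refl

module _ {A : Set} (P : A → Set) (f : A → ℕ) {j n : ℕ} where

  Σ-≡∸↔Σ-+≡ : j ≤ n → Σ A (λ a → P a × f a ≡ n ∸ j) ↔ Σ A (λ a → P a × f a + j ≡ n)
  Σ-≡∸↔Σ-+≡ j≤n = mk↔ₛ′
    (λ { (a , p , e) → a , p , ≡-trans (cong (_+ j) e) (m∸n+n≡m j≤n) })
    (λ { (a , p , e) → a , p , ≡-trans (sym (m+n∸n≡m _ j)) (cong (_∸ j) e) })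
    (λ { (a , p , e) → cong (λ e′ → a , p , e′) (≡-irrelevant _ _) })
    (λ { (a , p , e) → cong (λ e′ → a , p , e′) (≡-irrelevant _ _) })

  Σ-+≡↔⊥ : ¬ j ≤ n → Σ A (λ a → P a × f a + j ≡ n) ↔ ⊥
  Σ-+≡↔⊥ j≰n = mk↔ₛ′ impossible (λ ()) (λ ()) (λ x → ⊥-elim (impossible x))
    where
    impossible : Σ A (λ a → P a × f a + j ≡ n) → ⊥
    impossible (_ , _ , e) = j≰n (subst (j ≤_) e (m≤n+m j _))

corollaryC : (n j z : ℕ) →
    Fin (JS n j z) ↔
      Σ (SBar j j × SBar (j + z) j)
        (λ p → SameStructure j (proj₁ p) (proj₂ p)
               × dim j (proj₁ p) + j ≡ n)
corollaryC n j z with j ≤? n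
... | yes j≤n =
  ↔-trans (≡⇒Fin↔ (hpoly-↭ (↭-sym (boxSizes↭jsArgs z 0 j)) (n ∸ j)))
  (↔-trans (Fin-hpoly↔SamePairs j (j + z) 1 j (n ∸ j)) (Σ-≡∸↔Σ-+≡ _ _ j≤n))
... | no j≰n = ↔-trans 0↔⊥ (↔-sym (Σ-+≡↔⊥ _ _ j≰n))
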